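{- Let $n,g,k$ be integers with $k\ge 1$ and $1\leq g\leq \left\lfloor \frac{n-k-2}{2}\right\rfloor$. Let $H_k$ be the graph obtained from three vertex-disjoint complete graphs $K_{n-k-g}$, $K_{k-1}$, $K_{g+1}$ by adding all edges between $K_{n-k-g}$ and $K_{k-1}$ and all edges between $K_{g+1}$ and $K_{k-1}$. Then $$\kappa_g(H_k)=k-1.$$
   Context: A set $S$ of vertices (possibly empty) is a cutset if $G-S$ is disconnected; for a non-negative integer $g$, a cutset is an $R_g$-cutset if every component of $G-S$ has at least $g+1$ vertices. If $G$ has an $R_g$-cutset, $\kappa_g(G)$ is the minimum cardinality of an $R_g$-cutset of $G$. -}

module Defs where

open import Data.Nat using (ℕ; zero; suc; _+_; _∸_; _≤_; _<_)
open import Data.Fin using (Fin; toℕ)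
open import Data.Fin.Subset using (Subset; _∈_; _∉_; ∣_∣)
open import Data.Product using (Σ; ∃; _×_; _,_)
open import Data.Sum using (_⊎_)
open import Relation.Nullary using (¬_)
open import Relation.Binary.PropositionalEquality using (_≡_; _≢_)
open import Function.Definitions using (Injective)

record Graph (n : ℕ) : Set₁ where
  field
    Adj    : Fin n → Fin n → Set
    sym    : ∀ {u v} → Adj u v → Adj v u
    irrefl : ∀ {u} → ¬ Adj u u
open Graph public

data Reach {n : ℕ} (G : Graph n) (S : Subset n) (u : Fin n) : Fin n → Set where
  here : u ∉ S → Reach G S u u
  step : ∀ {v w} → Reach G S u v → Adj G v w → w ∉ S → Reach G S u w

IsCutset : {n : ℕ} → Graph n → Subset n → Set
IsCutset {n} G S = Σ (Fin n) λ u → Σ (Fin n) λ v → u ∉ S × v ∉ S × ¬ Reach G S u v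

-- The component of G - S containing v has at least m vertices:
-- there are m distinct vertices reachable from v in G - S.
CompAtLeast : {n : ℕ} → Graph n → Subset n → Fin n → ℕ → Set
CompAtLeast {n} G S v m =
  Σ (Fin m → Fin n) λ f → Injective _≡_ _≡_ f × (∀ i → Reach G S v (f i))

IsRgCutset : {n : ℕ} → ℕ → Graph n → Subset n → Set
IsRgCutset {n} g G S = IsCutset G S × (∀ v → v ∉ S → CompAtLeast G S v (suc g))

KappaIs : {n : ℕ} → ℕ → Graph n → ℕ → Set
KappaIs {n} g G m =
  (Σ (Subset n) λ S → IsRgCutset g G S × ∣ S ∣ ≡ m)
  × (∀ S → IsRgCutset g G S → m ≤ ∣ S ∣)

-- H_k on vertex set Fin n: vertices with index < a form K_a (a = n-k-g),
-- indices in [a, a+(k-1)) form K_{k-1}, the remaining g+1 form K_{g+1}.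
-- All pairs of distinct vertices are adjacent except pairs between the first and last block.
module _ (n g k : ℕ) where
  private
    a : ℕ
    a = n ∸ k ∸ g
  InA InC : Fin n → Set
  InA i = toℕ i < a
  InC i = a + (k ∸ 1) ≤ toℕ i

  HAdj : Fin n → Fin n → Set
  HAdj i j = i ≢ j × ¬ ((InA i × InC j) ⊎ (InC i × InA j))

open import Data.Sum using (inj₁; inj₂)
open import Data.Product using (proj₁; proj₂)
open import Relation.Binary.PropositionalEquality using (sym)

H : (n g k : ℕ) → Graph n
H n g k = record
  { Adj = HAdj n g k
  ; sym = λ { (ne , no) → (λ e → ne (Relation.Binary.PropositionalEquality.sym e))
                        , (λ { (inj₁ (x , y)) → no (inj₂ (y , x)) ; (inj₂ (x , y)) → no (inj₁ (y , x)) }) }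
  ; irrefl = λ { (ne , _) → ne Relation.Binary.PropositionalEquality.refl }
  }

-- Removing the middle clique K_{k-1} separates K_{n-k-g} from K_{g+1}, and both
-- have at least g+1 vertices, so it is an R_g-cutset of size k-1. Conversely, a
-- middle vertex is adjacent to every other vertex, so a vertex set whose removal
-- disconnects the graph must contain the whole middle clique.
module Submission where

open import Defs using (Graph; Adj; Reach; here; step; IsCutset; CompAtLeast; KappaIs; H)
open import Data.Nat using (ℕ; zero; suc; _≤_; _<_; _+_; _∸_; _*_; _/_; z≤n; s≤s)
open import Data.Nat.Properties hiding (_≟_)
open import Data.Nat.DivMod using (m/n*n≤m)
open import Data.Nat.Tactic.RingSolver using (solve-∀)
open import Data.Fin using (Fin; zero; suc; toℕ; inject≤; _↑ʳ_; _≟_)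
open import Data.Fin.Properties using (toℕ<n; toℕ-inject≤; toℕ-↑ʳ; inject≤-injective; ↑ʳ-injective)
open import Data.Fin.Subset using (Subset; _∈_; _∉_; ∣_∣; inside; outside; ⊥)
open import Data.Fin.Subset.Properties using (_∈?_; ∉⊥; ∣⊥∣≡0; p⊆q⇒∣p∣≤∣q∣)
open import Data.Vec using ([]; _∷_; here; there)
open import Data.Product using (_×_; _,_; proj₂)
open import Data.Sum using (_⊎_; inj₁; inj₂)
open import Data.Empty using (⊥-elim)
open import Function.Definitions using (Injective)
open import Relation.Nullary using (¬_; yes; no)
open import Relation.Binary.PropositionalEquality using (_≡_; _≢_; refl; sym; trans; cong; subst; module ≡-Reasoning)

interval : (n lo m : ℕ) → Subset n
interval n       zero     zero    = ⊥
interval zero    _        _       = []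
interval (suc n) zero     (suc m) = inside ∷ interval n zero m
interval (suc n) (suc lo) m       = outside ∷ interval n lo m

∈interval⁻ : ∀ {n} lo m {i : Fin n} → i ∈ interval n lo m → lo ≤ toℕ i × toℕ i < lo + m
∈interval⁻ zero     zero    i∈        = ⊥-elim (∉⊥ i∈)
∈interval⁻ zero     (suc m) here      = z≤n , s≤s z≤n
∈interval⁻ zero     (suc m) (there p) with ∈interval⁻ zero m p
... | _ , i<m = z≤n , s≤s i<m
∈interval⁻ (suc lo) m       (there p) with ∈interval⁻ lo m p
... | lo≤i , i<lo+m = s≤s lo≤i , s≤s i<lo+m

∈interval⁺ : ∀ {n} lo m {i : Fin n} → lo ≤ toℕ i → toℕ i < lo + m → i ∈ interval n lo m
∈interval⁺ zero     (suc m) {zero}  _          _            = here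
∈interval⁺ zero     (suc m) {suc i} _          (s≤s i<m)    = there (∈interval⁺ zero m z≤n i<m)
∈interval⁺ (suc lo) m       {suc i} (s≤s lo≤i) (s≤s i<lo+m) = there (∈interval⁺ lo m lo≤i i<lo+m)

∣interval∣≡m : ∀ n lo m → lo + m ≤ n → ∣ interval n lo m ∣ ≡ m
∣interval∣≡m n       zero     zero    _        = ∣⊥∣≡0 n
∣interval∣≡m (suc n) zero     (suc m) (s≤s le) = cong suc (∣interval∣≡m n zero m le)
∣interval∣≡m (suc n) (suc lo) m       (s≤s le) = ∣interval∣≡m n lo m le

offset : ∀ {m n} lo → lo + m ≤ n → Fin m → Fin n
offset lo le i = inject≤ (lo ↑ʳ i) le

toℕ-offset : ∀ {m n} lo (le : lo + m ≤ n) i → toℕ (offset lo le i) ≡ lo + toℕ i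
toℕ-offset lo le i = trans (toℕ-inject≤ (lo ↑ʳ i) le) (toℕ-↑ʳ lo i)

offset-injective : ∀ {m n} lo (le : lo + m ≤ n) → Injective _≡_ _≡_ (offset lo le)
offset-injective lo le {i} {j} eq = ↑ʳ-injective lo i j (inject≤-injective le le _ _ eq)

module Blocks {n : ℕ} (a m : ℕ) where

  InA InB InC : Fin n → Set
  InA i = toℕ i < a
  InB i = a ≤ toℕ i × toℕ i < a + m
  InC i = a + m ≤ toℕ i

  Across : Fin n → Fin n → Set
  Across i j = (InA i × InC j) ⊎ (InC i × InA j)

  A-C-disjoint : ∀ {i} → InA i → ¬ InC i
  A-C-disjoint i<a a+m≤i = <⇒≱ i<a (≤-trans (m≤m+n a m) a+m≤i)

  A-¬Across : ∀ {i j} → InA i → InA j → ¬ Across i j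
  A-¬Across _  jA (inj₁ (_ , jC)) = A-C-disjoint jA jC
  A-¬Across iA _  (inj₂ (iC , _)) = A-C-disjoint iA iC

  C-¬Across : ∀ {i j} → InC i → InC j → ¬ Across i j
  C-¬Across iC _  (inj₁ (iA , _)) = A-C-disjoint iA iC
  C-¬Across _  jC (inj₂ (_ , jA)) = A-C-disjoint jA jC

  B-¬Acrossˡ : ∀ {i j} → InB i → ¬ Across i j
  B-¬Acrossˡ (a≤i , _) (inj₁ (i<a , _)) = <⇒≱ i<a a≤i
  B-¬Acrossˡ (_ , i<b) (inj₂ (b≤i , _)) = <⇒≱ i<b b≤i

  B-¬Acrossʳ : ∀ {i j} → InB j → ¬ Across i j
  B-¬Acrossʳ (_ , j<b) (inj₁ (_ , b≤j)) = <⇒≱ j<b b≤j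
  B-¬Acrossʳ (a≤j , _) (inj₂ (_ , j<a)) = <⇒≱ j<a a≤j

  middle : Subset n
  middle = interval n a m

  InA⇒∉middle : ∀ {i} → InA i → i ∉ middle
  InA⇒∉middle i<a i∈ = let a≤i , _ = ∈interval⁻ a m i∈ in <⇒≱ i<a a≤i

  InC⇒∉middle : ∀ {i} → InC i → i ∉ middle
  InC⇒∉middle b≤i i∈ = let _ , i<b = ∈interval⁻ a m i∈ in <⇒≱ i<b b≤i

  ∉middle⇒InA⊎InC : ∀ {i} → i ∉ middle → InA i ⊎ InC i
  ∉middle⇒InA⊎InC {i} i∉ with toℕ i <? a | toℕ i <? a + m
  ... | yes i<a | _       = inj₁ i<a
  ... | no  i≮a | yes i<b = ⊥-elim (i∉ (∈interval⁺ a m (≮⇒≥ i≮a) i<b))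
  ... | no  _   | no  i≮b = inj₂ (≮⇒≥ i≮b)

module ThreeBlockGraph {n : ℕ} (a m : ℕ) (G : Graph n) where
  open Blocks {n} a m

  module _ (adjacent : ∀ {i j} → i ≢ j → ¬ Across i j → Adj G i j)
           (adjacent⇒¬Across : ∀ {i j} → Adj G i j → ¬ Across i j) where

    reach-extend : ∀ {S u x y} → Reach G S u x → y ∉ S → ¬ Across x y → Reach G S u y
    reach-extend {x = x} {y} u⇝x y∉ ¬across with x ≟ y
    ... | yes refl = u⇝x
    ... | no  x≢y  = step u⇝x (adjacent x≢y ¬across) y∉

    reach-¬Across : ∀ {S x y} → x ∉ S → y ∉ S → ¬ Across x y → Reach G S x y
    reach-¬Across x∉ = reach-extend (here x∉)

    cutset⇒InB⇒∈ : ∀ {S i} → IsCutset G S → InB i → i ∈ S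
    cutset⇒InB⇒∈ {S} {i} (u , v , u∉ , v∉ , u↛v) iB with i ∈? S
    ... | yes i∈ = i∈
    ... | no  i∉ = ⊥-elim (u↛v (reach-extend (reach-¬Across u∉ i∉ (B-¬Acrossʳ iB)) v∉ (B-¬Acrossˡ iB)))

    reach-∖middle-preserves-InA : ∀ {u w} → InA u → Reach G middle u w → InA w
    reach-∖middle-preserves-InA uA (here _) = uA
    reach-∖middle-preserves-InA uA (step u⇝v v~w w∉) with ∉middle⇒InA⊎InC w∉
    ... | inj₁ wA = wA
    ... | inj₂ wC = ⊥-elim (adjacent⇒¬Across v~w (inj₁ (reach-∖middle-preserves-InA uA u⇝v , wC)))

    module _ (g : ℕ) (A-large : suc g ≤ a) (C-large : a + m + suc g ≤ n) where

      private
        A-fits : 0 + suc g ≤ n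
        A-fits = ≤-trans A-large (m+n≤o⇒m≤o a (m+n≤o⇒m≤o (a + m) C-large))

      A-vertex C-vertex : Fin (suc g) → Fin n
      A-vertex = offset 0 A-fits
      C-vertex = offset (a + m) C-large

      InA-A-vertex : ∀ i → InA (A-vertex i)
      InA-A-vertex i = subst (_< a) (sym (toℕ-offset 0 A-fits i)) (≤-trans (toℕ<n i) A-large)

      InC-C-vertex : ∀ i → InC (C-vertex i)
      InC-C-vertex i = subst (a + m ≤_) (sym (toℕ-offset (a + m) C-large i)) (m≤m+n (a + m) (toℕ i))

      middle-isCutset : IsCutset G middle
      middle-isCutset = u , v , InA⇒∉middle uA , InC⇒∉middle vC ,
                        λ u⇝v → A-C-disjoint (reach-∖middle-preserves-InA uA u⇝v) vC
        where
        u = A-vertex zero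
        v = C-vertex zero
        uA = InA-A-vertex zero
        vC = InC-C-vertex zero

      component-∖middle : ∀ v → v ∉ middle → CompAtLeast G middle v (suc g)
      component-∖middle v v∉ with ∉middle⇒InA⊎InC v∉
      ... | inj₁ vA = A-vertex , offset-injective 0 A-fits , λ i →
        reach-¬Across v∉ (InA⇒∉middle (InA-A-vertex i)) (A-¬Across vA (InA-A-vertex i))
      ... | inj₂ vC = C-vertex , offset-injective (a + m) C-large , λ i →
        reach-¬Across v∉ (InC⇒∉middle (InC-C-vertex i)) (C-¬Across vC (InC-C-vertex i))

      κg≡m : KappaIs g G m
      κg≡m = (middle , (middle-isCutset , component-∖middle) , ∣interval∣≡m n a m b≤n) ,
             λ S (S-cut , _) → subst (_≤ ∣ S ∣) (∣interval∣≡m n a m b≤n)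
               (p⊆q⇒∣p∣≤∣q∣ (λ i∈ → cutset⇒InB⇒∈ S-cut (∈interval⁻ a m i∈)))
        where
        b≤n : a + m ≤ n
        b≤n = m+n≤o⇒m≤o (a + m) C-large

g≤[n∸o]/2⇒g*2+o≤n : ∀ n o {g} → 1 ≤ g → g ≤ (n ∸ o) / 2 → g * 2 + o ≤ n
g≤[n∸o]/2⇒g*2+o≤n n o {g} 1≤g g≤[n∸o]/2 = m≤o∸n⇒m+n≤o (g * 2) o≤n g*2≤n∸o
  where
  g*2≤n∸o : g * 2 ≤ n ∸ o
  g*2≤n∸o = ≤-trans (*-monoˡ-≤ 2 g≤[n∸o]/2) (m/n*n≤m (n ∸ o) 2)
  o≤n : o ≤ n
  o≤n = <⇒≤ (m∸n≢0⇒n<m λ n∸o≡0 → <⇒≢ (≤-trans (s≤s z≤n) (≤-trans (*-monoˡ-≤ 2 1≤g) g*2≤n∸o)) (sym n∸o≡0))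

lemma5p2 : (n g k : ℕ) → 1 ≤ k → 1 ≤ g → g ≤ (n ∸ (k + 2)) / 2 →
    KappaIs g (H n g k) (k ∸ 1)
-- H n g k is the three-block graph with a = n ∸ k ∸ g and m = k ∸ 1, with adjacency literally i ≢ j × ¬ Across i j.
lemma5p2 n g (suc k′) _ 1≤g g≤[n∸k∸2]/2 =
  ThreeBlockGraph.κg≡m a k′ (H n g k) _,_ proj₂ g g<a (≤-reflexive a+k′+[g+1]≡n)
  where
  regroup-bound : ∀ g k′ → suc (suc g + (suc k′ + g)) ≡ g * 2 + (suc k′ + 2)
  regroup-bound = solve-∀
  regroup-blocks : ∀ a k′ g → a + k′ + suc g ≡ a + (suc k′ + g)
  regroup-blocks = solve-∀
  k = suc k′
  a = n ∸ k ∸ g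
  g+1+[k+g]≤n : suc g + (k + g) ≤ n
  g+1+[k+g]≤n = ≤-trans (≤-trans (n≤1+n _) (≤-reflexive (regroup-bound g k′)))
                        (g≤[n∸o]/2⇒g*2+o≤n n (k + 2) 1≤g g≤[n∸k∸2]/2)
  g<a : suc g ≤ a
  g<a = subst (suc g ≤_) (sym (∸-+-assoc n k g)) (m+n≤o⇒m≤o∸n (suc g) g+1+[k+g]≤n)
  a+k′+[g+1]≡n : a + k′ + suc g ≡ n
  a+k′+[g+1]≡n = begin
    a + k′ + suc g        ≡⟨ regroup-blocks a k′ g ⟩
    a + (k + g)           ≡⟨ cong (_+ (k + g)) (∸-+-assoc n k g) ⟩
    n ∸ (k + g) + (k + g) ≡⟨ m∸n+n≡m (m+n≤o⇒n≤o (suc g) g+1+[k+g]≤n) ⟩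
    n                     ∎
    where open ≡-Reasoning
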